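{- Let $\Delta$ be any dynamic theory, and let $\alpha$ range over programs of $\Delta$, $\phi,\psi$ over $\Delta$-formulas and $v$ over variables of $\Delta$. Then the following rule and axioms are sound for $\Delta$: (G) if $\phi$ is $\Delta$-valid then $[\alpha]\phi$ is $\Delta$-valid; (K) $[\alpha](\phi\to\psi)\to([\alpha]\phi\to[\alpha]\psi)$ is $\Delta$-valid; (V) $\phi\to[\alpha]\phi$ is $\Delta$-valid whenever $\mathrm{FV}^{sem}(\phi)\cap\mathrm{BV}^{sem}(\alpha)=\emptyset$; (B) $(\forall v\,[\alpha]\phi)\leftrightarrow([\alpha]\forall v\,\phi)$ is $\Delta$-valid whenever $v\notin \mathrm{FV}^{sem}(\alpha)\cup\mathrm{BV}^{sem}(\alpha)$.
   Context: A dynamic theory $\Delta$ consists of: pairwise disjoint sets $\mathcal V$ (variables), $\mathcal A$ (atoms), $\mathcal P$ (programs); a nonempty set $U$ (universe); a nonempty set $S$ of states with a map $\mathrm{val}:S\times\mathcal V\to U$ satisfying interpolation (for all $\mu,\nu\in S$ and $W\subseteq\mathcal V$ there is $\omega\in S$ with $\mathrm{val}(\omega,v)=\mathrm{val}(\mu,v)$ for $v\in W$ and $\mathrm{val}(\omega,v)=\mathrm{val}(\nu,v)$ for $v\notin W$); an atom evaluation $\mathcal E_A:\mathcal A\to 2^S$ with $\mathrm{FV}_A:\mathcal A\to 2^{\mathcal V}$ such that each $\mathrm{FV}_A(a)$ is finite and states agreeing on $\mathrm{FV}_A(a)$ either both lie in $\mathcal E_A(a)$ or neither does; a program evaluation $\mathcal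 E_P:\mathcal P\to 2^{S\times S}$ with $\mathrm{FV}_P:\mathcal P\to 2^{\mathcal V}$ such that each $\mathrm{FV}_P(p)$ is finite, (overapproximation) for all $p$, all $\mu,\nu,\omega\in S$ and all $W\supseteq \mathrm{FV}_P(p)$: if $\mu=_W\nu$ and $(\mu,\omega)\in\mathcal E_P(p)$ then there is $\tilde\omega$ with $(\nu,\tilde\omega)\in\mathcal E_P(p)$ and $\omega=_W\tilde\omega$, and (extensionality) if $\mu=_{\mathcal V}\nu$ then $(\mu,\omega)\in\mathcal E_P(p)$ iff $(\nu,\omega)\in\mathcal E_P(p)$. Here $\mu=_W\nu$ means $\mathrm{val}(\mu,v)=\mathrm{val}(\nu,v)$ for all $v\in W$. Formulas: $F::=a\mid\neg F\mid F\wedge G\mid\forall v\,F\mid[p]F$ ($a\in\mathcal A,v\in\mathcal V,p\in\mathcal P$); $\langle p\rangle F$ abbreviates $\neg[p]\neg F$; other connectives and $\exists$ as usual. Semantics $[\![F]\!]\subseteq S$: $[\![a]\!]=\mathcal E_A(a)$, $[\![\neg F]\!]=S\setminus[\![F]\!]$, $[\![F\wedge G]\!]=[\![F]\!]\cap[\![G]\!]$, $[\![\forall v F]\!]=\{\mu:\forall\nu\,(\mu=_{\mathcal V\setminus\{v\}}\nu\Rightarrow\nu\in[\![F]\!])\}$, $[\![[p]F]\!]=\{\mu:\forall\nu\,((\mu,\nu)\in\mathcal E_P(p)\Rightarrow\nu\in[\![F]\!])\}$. $F$ is $\Delta$-valid iff $[\![F]\!]=S$. Semantic free/bound variables: $\mathrm{FV}^{sem}(F)=\{v:\exists\mu,\tilde\mu,\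 \mu=_{\mathcal V\setminus\{v\}}\tilde\mu,\ \mu\in[\![F]\!],\ \tilde\mu\notin[\![F]\!]\}$; $\mathrm{FV}^{sem}(p)=\{v:\exists\mu,\tilde\mu,\nu$ with $\mu=_{\mathcal V\setminus\{v\}}\tilde\mu$, $(\mu,\nu)\in\mathcal E_P(p)$, and no $\tilde\nu$ with $\nu=_{\mathcal V\setminus\{v\}}\tilde\nu$ and $(\tilde\mu,\tilde\nu)\in\mathcal E_P(p)\}$; $\mathrm{BV}^{sem}(p)=\{v:\exists(\mu,\tilde\mu)\in\mathcal E_P(p),\ \mathrm{val}(\mu,v)\neq\mathrm{val}(\tilde\mu,v)\}$. An axiom is sound if all its instances are valid; a rule is sound if validity of its premises implies validity of its conclusion. -}

module Defs where

open import Level using (Level; _⊔_) renaming (suc to lsuc)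
open import Data.List using (List)
open import Data.List.Membership.Propositional using (_∈_)
open import Data.Product using (Σ; _×_; _,_; ∃)
open import Data.Empty using (⊥)
open import Relation.Nullary using (¬_)
open import Relation.Binary.PropositionalEquality using (_≡_; _≢_)

-- Variables, atoms and programs are three separate
-- types (hence pairwise disjoint).  Subsets of a type X are predicates
-- X → Set ℓ; finite sets of variables (FV_A, FV_P) are given by lists.
record DynamicTheory (ℓ : Level) : Set (lsuc ℓ) where
  field
    Var   : Set ℓ
    Atom  : Set ℓ
    Prog  : Set ℓ
    U     : Set ℓ
    u₀    : U                       -- U nonempty
    S     : Set ℓ
    s₀    : S                       -- S nonempty
    val   : S → Var → U

  _=[_]_ : S → (Var → Set ℓ) → S → Set ℓ
  μ =[ W ] ν = ∀ v → W v → val μ v ≡ val ν v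

  _=all_ : S → S → Set ℓ
  μ =all ν = ∀ v → val μ v ≡ val ν v

  _=except[_]_ : S → Var → S → Set ℓ
  μ =except[ v ] ν = ∀ w → w ≢ v → val μ w ≡ val ν w

  field
    interpolation : ∀ (μ ν : S) (W : Var → Set ℓ) →
      Σ S λ ω → (∀ v → W v → val ω v ≡ val μ v)
              × (∀ v → ¬ W v → val ω v ≡ val ν v)
    EA   : Atom → S → Set ℓ
    FVA  : Atom → List Var
    EA-coincidence : ∀ a μ ν → (∀ v → v ∈ FVA a → val μ v ≡ val ν v) →
      (EA a μ → EA a ν) × (EA a ν → EA a μ)
    EP   : Prog → S → S → Set ℓ
    FVP  : Prog → List Var
    overapproximation : ∀ p (μ ν ω : S) (W : Var → Set ℓ) →
      (∀ v → v ∈ FVP p → W v) →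
      μ =[ W ] ν → EP p μ ω →
      Σ S λ ω̃ → EP p ν ω̃ × ω =[ W ] ω̃
    extensionality : ∀ p (μ ν ω : S) → μ =all ν →
      (EP p μ ω → EP p ν ω) × (EP p ν ω → EP p μ ω)

module _ {ℓ : Level} (Δ : DynamicTheory ℓ) where
  open DynamicTheory Δ

  data Fm : Set ℓ where
    atom : Atom → Fm
    ¬f   : Fm → Fm
    _∧f_ : Fm → Fm → Fm
    ∀f   : Var → Fm → Fm
    [_]f : Prog → Fm → Fm

  _→f_ : Fm → Fm → Fm
  φ →f ψ = ¬f (φ ∧f ¬f ψ)

  _↔f_ : Fm → Fm → Fm
  φ ↔f ψ = (φ →f ψ) ∧f (ψ →f φ)

  ⟦_⟧ : Fm → S → Set ℓ
  ⟦ atom a ⟧ μ = EA a μ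
  ⟦ ¬f F ⟧ μ = ¬ ⟦ F ⟧ μ
  ⟦ F ∧f G ⟧ μ = ⟦ F ⟧ μ × ⟦ G ⟧ μ
  ⟦ ∀f v F ⟧ μ = ∀ ν → μ =except[ v ] ν → ⟦ F ⟧ ν
  ⟦ [ p ]f F ⟧ μ = ∀ ν → EP p μ ν → ⟦ F ⟧ ν

  Valid : Fm → Set ℓ
  Valid F = ∀ μ → ⟦ F ⟧ μ

  FVsemF : Fm → Var → Set ℓ
  FVsemF F v = Σ S λ μ → Σ S λ μ̃ → μ =except[ v ] μ̃ × ⟦ F ⟧ μ × ¬ ⟦ F ⟧ μ̃

  FVsemP : Prog → Var → Set ℓ
  FVsemP p v = Σ S λ μ → Σ S λ μ̃ → Σ S λ ν →
    μ =except[ v ] μ̃ × EP p μ ν ×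
    ¬ (Σ S λ ν̃ → ν =except[ v ] ν̃ × EP p μ̃ ν̃)

  BVsemP : Prog → Var → Set ℓ
  BVsemP p v = Σ S λ μ → Σ S λ μ̃ → EP p μ μ̃ × val μ v ≢ val μ̃ v

{-# OPTIONS --safe #-}
-- (G) and (K) hold for any Kripke-style box.  (V) and (B) rest on the
-- coincidence lemma for the finite syntactic overapproximation fv φ of the
-- free variables of φ: the semantic conditions only control changing one
-- variable at a time, so a run μ → ν of α is matched by moving from μ to ν
-- one variable of fv φ at a time.  A variable on which μ and ν differ is
-- bound by α, hence (for (V)) not free in φ, so φ survives every step.
module Submission where

open import Defs
open import Level using (Level)
open import Axiom.ExcludedMiddle using (ExcludedMiddle)
open import Axiom.DoubleNegationElimination using (DoubleNegationElimination; em⇒dne)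
open import Data.Product using (_×_; _,_; Σ; proj₁; proj₂)
open import Data.Empty using (⊥; ⊥-elim)
open import Data.List using (List; []; _∷_; _++_)
open import Data.List.Membership.Propositional using (_∈_)
open import Data.List.Membership.Propositional.Properties using (∈-++⁺ˡ; ∈-++⁺ʳ)
open import Data.List.Relation.Unary.Any using (here; there)
open import Function using (_∘_)
open import Relation.Nullary using (¬_; yes; no)
open import Relation.Binary.PropositionalEquality using (_≡_; _≢_; refl; sym; trans)

module _ {ℓ : Level} (Δ : DynamicTheory ℓ) where
  open DynamicTheory Δ

  infix 4 _⊨_

  _⊨_ : S → Fm Δ → Set ℓ
  μ ⊨ φ = ⟦_⟧ Δ φ μ

  =[]-sym : ∀ {W μ ν} → μ =[ W ] ν → ν =[ W ] μ
  =[]-sym μ=ν w w∈W = sym (μ=ν w w∈W)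

  =except-sym : ∀ {v μ ν} → μ =except[ v ] ν → ν =except[ v ] μ
  =except-sym μ=ν w w≢v = sym (μ=ν w w≢v)

  update : S → Var → S → S
  update μ v ν = proj₁ (interpolation ν μ (_≡ v))

  update-at : ∀ μ v ν → val (update μ v ν) v ≡ val ν v
  update-at μ v ν = proj₁ (proj₂ (interpolation ν μ (_≡ v))) v refl

  update-except : ∀ μ v ν → μ =except[ v ] update μ v ν
  update-except μ v ν w w≢v = sym (proj₂ (proj₂ (interpolation ν μ (_≡ v))) w w≢v)

  fv : Fm Δ → List Var
  fv (atom a)   = FVA a
  fv (¬f φ)     = fv φ
  fv (φ ∧f ψ)   = fv φ ++ fv ψ
  fv (∀f v φ)   = fv φ
  fv ([ α ]f φ) = FVP α ++ fv φ

  →f-intro : ∀ φ ψ μ → (μ ⊨ φ → μ ⊨ ψ) → μ ⊨ _→f_ Δ φ ψ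
  →f-intro φ ψ μ φ⇒ψ (φμ , ¬ψμ) = ¬ψμ (φ⇒ψ φμ)

  G-rule-sound : ∀ α φ → Valid Δ φ → Valid Δ ([ α ]f φ)
  G-rule-sound α φ ⊨φ μ ν _ = ⊨φ ν

  module _ (em : ExcludedMiddle ℓ) where

    dne : DoubleNegationElimination ℓ
    dne = em⇒dne em

    →f-elim : ∀ φ ψ μ → μ ⊨ _→f_ Δ φ ψ → μ ⊨ φ → μ ⊨ ψ
    →f-elim φ ψ μ φ→ψ φμ = dne λ ¬ψμ → φ→ψ (φμ , ¬ψμ)

    K-axiom-valid : ∀ α φ ψ →
      Valid Δ (_→f_ Δ ([ α ]f (_→f_ Δ φ ψ)) (_→f_ Δ ([ α ]f φ) ([ α ]f ψ)))
    K-axiom-valid α φ ψ μ =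
      →f-intro ([ α ]f (_→f_ Δ φ ψ)) (_→f_ Δ ([ α ]f φ) ([ α ]f ψ)) μ λ □φ→ψ →
        →f-intro ([ α ]f φ) ([ α ]f ψ) μ λ □φ ν μ→ν →
          →f-elim φ ψ ν (□φ→ψ ν μ→ν) (□φ ν μ→ν)

    agree-except-and-at : ∀ {W μ ν} v → (∀ w → w ≢ v → W w → val μ w ≡ val ν w) →
      val μ v ≡ val ν v → μ =[ W ] ν
    agree-except-and-at v off at w w∈W with em {w ≡ v}
    ... | yes refl = at
    ... | no w≢v   = off w w≢v w∈W

    coincidence : ∀ φ {μ ν} → μ =[ _∈ fv φ ] ν → μ ⊨ φ → ν ⊨ φ
    coincidence (atom a) μ=ν = proj₁ (EA-coincidence a _ _ μ=ν)
    coincidence (¬f φ) μ=ν ¬φμ φν = ¬φμ (coincidence φ (=[]-sym μ=ν) φν)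
    coincidence (φ ∧f ψ) μ=ν (φμ , ψμ) =
      coincidence φ (λ w → μ=ν w ∘ ∈-++⁺ˡ) φμ ,
      coincidence ψ (λ w → μ=ν w ∘ ∈-++⁺ʳ (fv φ)) ψμ
    coincidence (∀f v φ) {μ} {ν} μ=ν ∀φμ ν′ ν=ν′ =
      coincidence φ μ′=ν′ (∀φμ μ′ (update-except μ v ν′))
      where
      μ′ : S
      μ′ = update μ v ν′
      μ′=ν′ : μ′ =[ _∈ fv φ ] ν′
      μ′=ν′ = agree-except-and-at v
        (λ w w≢v w∈ → trans (sym (update-except μ v ν′ w w≢v)) (trans (μ=ν w w∈) (ν=ν′ w w≢v)))
        (update-at μ v ν′)
    coincidence ([ α ]f φ) μ=ν □φμ ν′ ν→ν′
      with overapproximation α _ _ ν′ (_∈ fv ([ α ]f φ)) (λ _ → ∈-++⁺ˡ) (=[]-sym μ=ν) ν→ν′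
    ... | μ′ , μ→μ′ , ν′=μ′ =
      coincidence φ (λ w → sym ∘ ν′=μ′ w ∘ ∈-++⁺ʳ (FVP α)) (□φμ μ′ μ→μ′)

    ¬FVsemF⇒invariant : ∀ φ {v μ μ̃} → ¬ FVsemF Δ φ v → μ =except[ v ] μ̃ → μ ⊨ φ → μ̃ ⊨ φ
    ¬FVsemF⇒invariant φ v∉FV μ=μ̃ φμ = dne λ ¬φμ̃ → v∉FV (_ , _ , μ=μ̃ , φμ , ¬φμ̃)

    ¬BVsemP⇒unchanged : ∀ α {v μ ν} → ¬ BVsemP Δ α v → EP α μ ν → val μ v ≡ val ν v
    ¬BVsemP⇒unchanged α v∉BV μ→ν = dne λ μv≢νv → v∉BV (_ , _ , μ→ν , μv≢νv)

    ¬FVsemP⇒simulation : ∀ α {v μ μ̃ ν} → ¬ FVsemP Δ α v → μ =except[ v ] μ̃ → EP α μ ν →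
      Σ S λ ν̃ → ν =except[ v ] ν̃ × EP α μ̃ ν̃
    ¬FVsemP⇒simulation α v∉FV μ=μ̃ μ→ν = dne λ ∄ν̃ → v∉FV (_ , _ , _ , μ=μ̃ , μ→ν , ∄ν̃)

    updates-reach : ∀ (P : S → Set ℓ) ν → (∀ ρ v → P ρ → P (update ρ v ν)) →
      ∀ K μ → P μ → Σ S λ ρ → P ρ × ρ =[ _∈ K ] ν
    updates-reach P ν step [] μ Pμ = μ , Pμ , λ _ ()
    updates-reach P ν step (v ∷ K) μ Pμ with updates-reach P ν step K μ Pμ
    ... | ρ , Pρ , ρ=ν = update ρ v ν , step ρ v Pρ , agree-except-and-at v off (update-at ρ v ν)
      where
      off : ∀ w → w ≢ v → w ∈ v ∷ K → val (update ρ v ν) w ≡ val ν w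
      off w w≢v (here w≡v)  = ⊥-elim (w≢v w≡v)
      off w w≢v (there w∈K) = trans (sym (update-except ρ v ν w w≢v)) (ρ=ν w w∈K)

    ⊨-preserved : ∀ α φ → (∀ v → FVsemF Δ φ v → BVsemP Δ α v → ⊥) →
      ∀ {μ ν} → EP α μ ν → μ ⊨ φ → ν ⊨ φ
    ⊨-preserved α φ disjoint {μ} {ν} μ→ν φμ
      with updates-reach Inv ν step (fv φ) μ (φμ , λ _ μw=νw → μw=νw)
      where
      -- The second component makes updating a variable on which μ and ν agree a no-op.
      Inv : S → Set ℓ
      Inv ρ = ρ ⊨ φ × ρ =[ (λ w → val μ w ≡ val ν w) ] ν
      step : ∀ ρ v → Inv ρ → Inv (update ρ v ν)
      step ρ v (φρ , ρ=ν) = φρ′ , agree-except-and-at v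
          (λ w w≢v μw=νw → trans (sym (update-except ρ v ν w w≢v)) (ρ=ν w μw=νw))
          (update-at ρ v ν)
        where
        φρ′ : update ρ v ν ⊨ φ
        φρ′ with em {val μ v ≡ val ν v}
        ... | yes μv=νv = coincidence φ
          (agree-except-and-at v (λ w w≢v _ → update-except ρ v ν w w≢v)
                                 (trans (ρ=ν v μv=νv) (sym (update-at ρ v ν))))
          φρ
        ... | no μv≢νv = ¬FVsemF⇒invariant φ
          (λ v∈FV → disjoint v v∈FV (μ , ν , μ→ν , μv≢νv)) (update-except ρ v ν) φρ
    ... | ρ , (φρ , _) , ρ=ν = coincidence φ ρ=ν φρ

    V-axiom-valid : ∀ α φ → (∀ v → FVsemF Δ φ v → BVsemP Δ α v → ⊥) →
      Valid Δ (_→f_ Δ φ ([ α ]f φ))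
    V-axiom-valid α φ disjoint μ =
      →f-intro φ ([ α ]f φ) μ λ φμ ν μ→ν → ⊨-preserved α φ disjoint μ→ν φμ

    B-axiom-valid : ∀ α φ v → ¬ FVsemP Δ α v → ¬ BVsemP Δ α v →
      Valid Δ (_↔f_ Δ (∀f v ([ α ]f φ)) ([ α ]f (∀f v φ)))
    B-axiom-valid α φ v v∉FV v∉BV μ =
      →f-intro (∀f v ([ α ]f φ)) ([ α ]f (∀f v φ)) μ ∀□⇒□∀ ,
      →f-intro ([ α ]f (∀f v φ)) (∀f v ([ α ]f φ)) μ □∀⇒∀□
      where
      ∀□⇒□∀ : μ ⊨ ∀f v ([ α ]f φ) → μ ⊨ [ α ]f (∀f v φ)
      ∀□⇒□∀ ∀□φ ν μ→ν ν′ ν=ν′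
        with ¬FVsemP⇒simulation α v∉FV (update-except μ v ν′) μ→ν
      ... | ν̃ , ν=ν̃ , μ′→ν̃ = coincidence φ ν̃=ν′ (∀□φ _ (update-except μ v ν′) ν̃ μ′→ν̃)
        where
        ν̃=ν′ : ν̃ =[ _∈ fv φ ] ν′
        ν̃=ν′ = agree-except-and-at v
          (λ w w≢v _ → trans (sym (ν=ν̃ w w≢v)) (ν=ν′ w w≢v))
          (trans (sym (¬BVsemP⇒unchanged α v∉BV μ′→ν̃)) (update-at μ v ν′))
      □∀⇒∀□ : μ ⊨ [ α ]f (∀f v φ) → μ ⊨ ∀f v ([ α ]f φ)
      □∀⇒∀□ □∀φ μ′ μ=μ′ ν′ μ′→ν′
        with ¬FVsemP⇒simulation α v∉FV (=except-sym μ=μ′) μ′→ν′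
      ... | ν̃ , ν′=ν̃ , μ→ν̃ = □∀φ ν̃ μ→ν̃ ν′ (=except-sym ν′=ν̃)

mainTheorem1 : {ℓ : Level} → ExcludedMiddle ℓ → (Δ : DynamicTheory ℓ) →
    -- (G)
    (∀ (α : DynamicTheory.Prog Δ) (φ : Fm Δ) → Valid Δ φ → Valid Δ ([_]f α φ))
    -- (K)
    × (∀ (α : DynamicTheory.Prog Δ) (φ ψ : Fm Δ) →
         Valid Δ (_→f_ Δ ([_]f α (_→f_ Δ φ ψ)) (_→f_ Δ ([_]f α φ) ([_]f α ψ))))
    -- (V)
    × (∀ (α : DynamicTheory.Prog Δ) (φ : Fm Δ) →
         (∀ v → FVsemF Δ φ v → BVsemP Δ α v → ⊥) →
         Valid Δ (_→f_ Δ φ ([_]f α φ)))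
    -- (B)
    × (∀ (α : DynamicTheory.Prog Δ) (φ : Fm Δ) v →
         ¬ FVsemP Δ α v → ¬ BVsemP Δ α v →
         Valid Δ (_↔f_ Δ (∀f v ([_]f α φ)) ([_]f α (∀f v φ))))
mainTheorem1 em Δ =
  G-rule-sound Δ , K-axiom-valid Δ em , V-axiom-valid Δ em , B-axiom-valid Δ em
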